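{- For all integers $r,n \geq 1$, \[ C_a(r,n) = (r+1)a_1(r+1,n-1) + r\,a_0(r,n). \]
   Context: For integers $r\ge0$ and $n\ge0$, $a(r,n)$ is the number of ways to tile a $1\times(n+r)$ grid using $r$ indistinguishable red $1\times1$ squares and white tiles of arbitrary positive integer lengths of total length $n$ (tiles cover the grid, meet only on boundaries, order matters); $a(r,n)=0$ for $n<0$. Set $a_0(r,n)=a(r,n)$ and $a_s(r,n)=\sum_{i=0}^n a_{s-1}(r,i)$ for $s\ge1$. $C_a(r,n)$ denotes the total number of tiles (red and white, i.e. parts) summed over all tilings counted by $a(r,n)$. -}

module Defs where

open import Data.Nat using (ℕ; zero; suc; _+_; _∸_)
open import Data.Nat.Properties using (_≟_)
open import Data.List using (List; []; _∷_; [_]; map; _++_; concatMap; upTo; length; filter)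
open import Data.Nat.ListAction using (sum)

-- A tile: a red 1×1 square, or a white tile of length (suc k) (positive length).
data Tile : Set where
  red   : Tile
  white : ℕ → Tile

reds : List Tile → ℕ
reds []            = 0
reds (red ∷ t)     = suc (reds t)
reds (white _ ∷ t) = reds t

-- All tilings (ordered lists of tiles) of a 1×N grid.
-- The first argument is fuel (always called with fuel = N, which suffices).
tilingsFuel : ℕ → ℕ → List (List Tile)
tilingsFuel _        zero    = [ [] ]
tilingsFuel zero     (suc N) = []
tilingsFuel (suc f) (suc N) =
  map (red ∷_) (tilingsFuel f N)
  ++ concatMap (λ k → map (white k ∷_) (tilingsFuel f (N ∸ k))) (upTo (suc N))
  -- white k has length suc k, k = 0..N; remaining length (suc N) - (suc k) = N ∸ k

tilingsOfLength : ℕ → List (List Tile)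
tilingsOfLength N = tilingsFuel N N

-- tilings counted by a(r,n): grid 1×(n+r), exactly r red squares
-- (so the white tiles have total length n)
tilingsA : ℕ → ℕ → List (List Tile)
tilingsA r n = filter (λ t → reds t ≟ r) (tilingsOfLength (n + r))

a : ℕ → ℕ → ℕ
a r n = length (tilingsA r n)

aS : ℕ → ℕ → ℕ → ℕ
aS zero    r n = a r n
aS (suc s) r n = sum (map (aS s r) (upTo (suc n)))

Ca : ℕ → ℕ → ℕ
Ca r n = sum (map length (tilingsA r n))

module Submission where

-- Every tiling counted by a(r,n) has exactly r red tiles, so its number of
-- tiles is r plus its number of white tiles; hence C_a(r,n) = r·a(r,n) + W(r,n)
-- where W(r,n) counts white tiles over all these tilings.  It remains to show
-- W(r,n) = (r+1)·Σ_{i<n} a(r+1,i), which we do by recurrences on the FIRST tile: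
--   a(r+1,n) = a(r,n) + Σ_{i<n} a(r+1,i),
--   W(r+1,n) = W(r,n) + Σ_{i<n} (a(r+1,i) + W(r+1,i)),
--   W(0,n)   =          Σ_{i<n} (a(0,i)   + W(0,i)),
-- (a first white tile of length n-i leaves a tiling of white length i and
-- contributes one white tile), followed by an induction on r and a strong
-- induction on n (lemma `closedForm`).

open import Defs
open import Data.Nat using (ℕ; zero; suc; _+_; _*_; _∸_; _≤_; _<_; s≤s)
open import Data.Nat.Properties
  using (_≟_; ≤-refl; ≤-trans; <⇒≤; m<n⇒m<1+n; m∸n≤m; +-assoc; +-comm; +-suc; +-identityʳ;
         *-zeroʳ; *-identityʳ; *-distribˡ-+; +-commutativeSemigroup)
open import Algebra.Properties.CommutativeSemigroup +-commutativeSemigroup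
  using () renaming (interchange to +-interchange)
open import Data.Nat.Induction using (<-rec)
open import Data.Nat.ListAction using (sum)
open import Data.Nat.ListAction.Properties using (sum-++)
open import Data.List using (List; []; _∷_; [_]; _∷ʳ_; map; _++_; concatMap; upTo; length; filter)
open import Data.List.Properties using (map-++; map-cong; map-∘; concatMap-cong; upTo-∷ʳ)
open import Data.Bool using (true; false; if_then_else_)
open import Function using (_∘_)
open import Relation.Nullary using (does; yes; no)
open import Relation.Nullary.Decidable using (dec-false)
open import Relation.Binary.PropositionalEquality using (_≡_; refl; sym; trans; cong; cong₂; module ≡-Reasoning)
open import Data.Nat.Tactic.RingSolver using (solve-∀)

open ≡-Reasoning

sumBelow : ℕ → (ℕ → ℕ) → ℕ
sumBelow zero    f = 0
sumBelow (suc n) f = sumBelow n f + f n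

sum-upTo : ∀ (f : ℕ → ℕ) n → sum (map f (upTo n)) ≡ sumBelow n f
sum-upTo f zero    = refl
sum-upTo f (suc n) = begin
  sum (map f (upTo (suc n)))        ≡⟨ cong (sum ∘ map f) (sym (upTo-∷ʳ n)) ⟩
  sum (map f (upTo n ∷ʳ n))         ≡⟨ cong sum (map-++ f (upTo n) [ n ]) ⟩
  sum (map f (upTo n) ++ [ f n ])   ≡⟨ sum-++ (map f (upTo n)) [ f n ] ⟩
  sum (map f (upTo n)) + (f n + 0)  ≡⟨ cong₂ _+_ (sum-upTo f n) (+-identityʳ (f n)) ⟩
  sumBelow n f + f n                ∎

sumBelow-shift : ∀ f n → sumBelow (suc n) f ≡ f 0 + sumBelow n (f ∘ suc)
sumBelow-shift f zero    = +-comm 0 (f 0)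
sumBelow-shift f (suc n) = begin
  sumBelow (suc n) f + f (suc n)                ≡⟨ cong (_+ f (suc n)) (sumBelow-shift f n) ⟩
  (f 0 + sumBelow n (f ∘ suc)) + f (suc n)      ≡⟨ +-assoc (f 0) _ _ ⟩
  f 0 + (sumBelow n (f ∘ suc) + f (suc n))      ∎

sumBelow-reverse : ∀ g M → sumBelow (suc M) (λ k → g (M ∸ k)) ≡ sumBelow (suc M) g
sumBelow-reverse g zero    = refl
sumBelow-reverse g (suc M) = begin
  sumBelow (suc (suc M)) (λ k → g (suc M ∸ k))  ≡⟨ sumBelow-shift (λ k → g (suc M ∸ k)) (suc M) ⟩
  g (suc M) + sumBelow (suc M) (λ k → g (M ∸ k)) ≡⟨ cong (g (suc M) +_) (sumBelow-reverse g M) ⟩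
  g (suc M) + sumBelow (suc M) g                 ≡⟨ +-comm (g (suc M)) _ ⟩
  sumBelow (suc (suc M)) g                       ∎

sumBelow-cong : ∀ {f g} n → (∀ i → i < n → f i ≡ g i) → sumBelow n f ≡ sumBelow n g
sumBelow-cong zero    eq = refl
sumBelow-cong (suc n) eq =
  cong₂ _+_ (sumBelow-cong n (λ i i<n → eq i (m<n⇒m<1+n i<n))) (eq n ≤-refl)

sumBelow-vanish : ∀ {f} n → (∀ i → i < n → f i ≡ 0) → sumBelow n f ≡ 0
sumBelow-vanish zero    zeros = refl
sumBelow-vanish (suc n) zeros =
  cong₂ _+_ (sumBelow-vanish n (λ i i<n → zeros i (m<n⇒m<1+n i<n))) (zeros n ≤-refl)

sumBelow-+ : ∀ f g n → sumBelow n (λ i → f i + g i) ≡ sumBelow n f + sumBelow n g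
sumBelow-+ f g zero    = refl
sumBelow-+ f g (suc n) =
  trans (cong (_+ (f n + g n)) (sumBelow-+ f g n)) (+-interchange (sumBelow n f) (sumBelow n g) (f n) (g n))

sumBelow-* : ∀ c f n → sumBelow n (λ i → c * f i) ≡ c * sumBelow n f
sumBelow-* c f zero    = sym (*-zeroʳ c)
sumBelow-* c f (suc n) =
  trans (cong (_+ c * f n) (sumBelow-* c f n)) (sym (*-distribˡ-+ c (sumBelow n f) (f n)))

sumBelow-dropZeros : ∀ f r n → (∀ j → j < r → f j ≡ 0) →
  sumBelow (n + r) f ≡ sumBelow n (λ i → f (i + r))
sumBelow-dropZeros f r zero    zeros = sumBelow-vanish r zeros
sumBelow-dropZeros f r (suc n) zeros = cong (_+ f (n + r)) (sumBelow-dropZeros f r n zeros)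

weigh : (List Tile → ℕ) → List (List Tile) → ℕ
weigh w ts = sum (map w ts)

sum-map-zero : ∀ {A : Set} (f : A → ℕ) xs → (∀ x → f x ≡ 0) → sum (map f xs) ≡ 0
sum-map-zero f []       vanishes = refl
sum-map-zero f (x ∷ xs) vanishes = cong₂ _+_ (vanishes x) (sum-map-zero f xs vanishes)

weigh-++ : ∀ w xs ys → weigh w (xs ++ ys) ≡ weigh w xs + weigh w ys
weigh-++ w xs ys = trans (cong sum (map-++ w xs ys)) (sum-++ (map w xs) (map w ys))

weigh-map : ∀ w (g : List Tile → List Tile) xs → weigh w (map g xs) ≡ weigh (w ∘ g) xs
weigh-map w g xs = cong sum (sym (map-∘ xs))

weigh-concatMap : ∀ w (g : ℕ → List (List Tile)) ks →
  weigh w (concatMap g ks) ≡ sum (map (λ k → weigh w (g k)) ks)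
weigh-concatMap w g []       = refl
weigh-concatMap w g (k ∷ ks) =
  trans (weigh-++ w (g k) (concatMap g ks)) (cong (weigh w (g k) +_) (weigh-concatMap w g ks))

weigh-cong : ∀ {w w'} → (∀ t → w t ≡ w' t) → ∀ xs → weigh w xs ≡ weigh w' xs
weigh-cong eq xs = cong sum (map-cong eq xs)

weigh-+ : ∀ w w' xs → weigh (λ t → w t + w' t) xs ≡ weigh w xs + weigh w' xs
weigh-+ w w' []       = refl
weigh-+ w w' (x ∷ xs) =
  trans (cong (w x + w' x +_) (weigh-+ w w' xs)) (+-interchange (w x) (w' x) (weigh w xs) (weigh w' xs))

weigh-* : ∀ c w xs → weigh (λ t → c * w t) xs ≡ c * weigh w xs
weigh-* c w []       = sym (*-zeroʳ c)
weigh-* c w (x ∷ xs) =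
  trans (cong (c * w x +_) (weigh-* c w xs)) (sym (*-distribˡ-+ c (w x) (weigh w xs)))

fuel-irrelevant : ∀ {f g} N → N ≤ f → N ≤ g → tilingsFuel f N ≡ tilingsFuel g N
fuel-irrelevant zero    _         _         = refl
fuel-irrelevant (suc N) (s≤s N≤f) (s≤s N≤g) =
  cong₂ _++_ (cong (map (red ∷_)) (fuel-irrelevant N N≤f N≤g))
    (concatMap-cong (λ k → cong (map (white k ∷_))
                              (fuel-irrelevant (N ∸ k) (≤-trans (m∸n≤m N k) N≤f) (≤-trans (m∸n≤m N k) N≤g)))
                    (upTo (suc N)))

weigh-firstTile : ∀ w f N →
  weigh w (tilingsFuel (suc f) (suc N))
    ≡ weigh (w ∘ (red ∷_)) (tilingsFuel f N)
      + sum (map (λ k → weigh (w ∘ (white k ∷_)) (tilingsFuel f (N ∸ k))) (upTo (suc N)))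
weigh-firstTile w f N = begin
  weigh w (reds-first ++ whites-first)
    ≡⟨ weigh-++ w reds-first whites-first ⟩
  weigh w reds-first + weigh w whites-first
    ≡⟨ cong₂ _+_ (weigh-map w (red ∷_) (tilingsFuel f N))
                 (trans (weigh-concatMap w after-white (upTo (suc N)))
                        (cong sum (map-cong (λ k → weigh-map w (white k ∷_) (tilingsFuel f (N ∸ k))) (upTo (suc N))))) ⟩
  weigh (w ∘ (red ∷_)) (tilingsFuel f N)
    + sum (map (λ k → weigh (w ∘ (white k ∷_)) (tilingsFuel f (N ∸ k))) (upTo (suc N))) ∎
  where
  reds-first whites-first : List (List Tile)
  reds-first   = map (red ∷_) (tilingsFuel f N)
  after-white : ℕ → List (List Tile)
  after-white  = λ k → map (white k ∷_) (tilingsFuel f (N ∸ k))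
  whites-first = concatMap after-white (upTo (suc N))

lengthWeight : (List Tile → ℕ) → ℕ → ℕ
lengthWeight w L = weigh w (tilingsOfLength L)

-- First-tile recurrence for a weight w that forgets a leading white tile
-- (w (white k ∷ t) = w' t): the tilings of length M+1 starting with a white
-- tile correspond to the tilings of each length j ≤ M.
lengthWeight-suc : ∀ w w' → (∀ k t → w (white k ∷ t) ≡ w' t) → ∀ M →
  lengthWeight w (suc M) ≡ lengthWeight (w ∘ (red ∷_)) M + sumBelow (suc M) (lengthWeight w')
lengthWeight-suc w w' forget M = begin
  lengthWeight w (suc M)
    ≡⟨ weigh-firstTile w M M ⟩
  lengthWeight (w ∘ (red ∷_)) M
    + sum (map (λ k → weigh (w ∘ (white k ∷_)) (tilingsFuel M (M ∸ k))) (upTo (suc M)))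
    ≡⟨ cong (lengthWeight (w ∘ (red ∷_)) M +_) (cong sum (map-cong afterWhite (upTo (suc M)))) ⟩
  lengthWeight (w ∘ (red ∷_)) M + sum (map (λ k → lengthWeight w' (M ∸ k)) (upTo (suc M)))
    ≡⟨ cong (lengthWeight (w ∘ (red ∷_)) M +_)
            (trans (sum-upTo (λ k → lengthWeight w' (M ∸ k)) (suc M)) (sumBelow-reverse (lengthWeight w') M)) ⟩
  lengthWeight (w ∘ (red ∷_)) M + sumBelow (suc M) (lengthWeight w') ∎
  where
  afterWhite : ∀ k → weigh (w ∘ (white k ∷_)) (tilingsFuel M (M ∸ k)) ≡ lengthWeight w' (M ∸ k)
  afterWhite k = trans (weigh-cong (forget k) (tilingsFuel M (M ∸ k)))
                       (cong (weigh w') (fuel-irrelevant (M ∸ k) (m∸n≤m M k) ≤-refl))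

restrict : ℕ → (List Tile → ℕ) → List Tile → ℕ
restrict r h t = if does (reds t ≟ r) then h t else 0

filter-as-restrict : ∀ r h xs →
  sum (map h (filter (λ t → reds t ≟ r) xs)) ≡ weigh (restrict r h) xs
filter-as-restrict r h []       = refl
filter-as-restrict r h (x ∷ xs) with does (reds x ≟ r)
... | true  = cong (h x +_) (filter-as-restrict r h xs)
... | false = filter-as-restrict r h xs

restrict-+ : ∀ r f g t → restrict r (λ t → f t + g t) t ≡ restrict r f t + restrict r g t
restrict-+ r f g t with does (reds t ≟ r)
... | true  = refl
... | false = refl

restrict-* : ∀ r c f t → restrict r (λ t → c * f t) t ≡ c * restrict r f t
restrict-* r c f t with does (reds t ≟ r)
... | true  = refl
... | false = sym (*-zeroʳ c)

-- A tiling of length N has at most N red squares, so the restricted weight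
-- vanishes on short tilings (proved by induction on the fuel).
restrict-short : ∀ f N r h → N < r → weigh (restrict r h) (tilingsFuel f N) ≡ 0
restrict-short f       zero    (suc r) h _         = refl
restrict-short zero    (suc N) (suc r) h _         = refl
restrict-short (suc f) (suc N) (suc r) h (s≤s N<r) =
  trans (weigh-firstTile (restrict (suc r) h) f N)
        (cong₂ _+_ (restrict-short f N r (h ∘ (red ∷_)) N<r)
                   (sum-map-zero _ (upTo (suc N)) afterWhite))
  where
  afterWhite : ∀ k → weigh (restrict (suc r) (h ∘ (white k ∷_))) (tilingsFuel f (N ∸ k)) ≡ 0
  afterWhite k = restrict-short f (N ∸ k) (suc r) (h ∘ (white k ∷_)) (s≤s (≤-trans (m∸n≤m N k) (<⇒≤ N<r)))

total : (List Tile → ℕ) → ℕ → ℕ → ℕ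
total h r n = lengthWeight (restrict r h) (n + r)

total-+ : ∀ f g r n → total (λ t → f t + g t) r n ≡ total f r n + total g r n
total-+ f g r n = trans (weigh-cong (restrict-+ r f g) (tilingsOfLength (n + r)))
                        (weigh-+ (restrict r f) (restrict r g) (tilingsOfLength (n + r)))

total-* : ∀ c f r n → total (λ t → c * f t) r n ≡ c * total f r n
total-* c f r n = trans (weigh-cong (restrict-* r c f) (tilingsOfLength (n + r)))
                        (weigh-* c (restrict r f) (tilingsOfLength (n + r)))

restrict-forget : ∀ {h h'} → (∀ k t → h (white k ∷ t) ≡ h' t) →
  ∀ r k t → restrict r h (white k ∷ t) ≡ restrict r h' t
restrict-forget forget r k t = cong (λ x → if does (reds t ≟ r) then x else 0) (forget k t)

-- The tilings after a leading white tile, of every length up to n + r - 1,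
-- are those counted by a(r, i) for i < n; shorter ones have too few cells.
whitesFirst : ∀ h r n → sumBelow (n + r) (lengthWeight (restrict r h)) ≡ sumBelow n (total h r)
whitesFirst h r n = sumBelow-dropZeros (lengthWeight (restrict r h)) r n (λ j j<r → restrict-short j j r h j<r)

-- With r+1 red squares the first
-- tile may be red; with none it is white (and n ≥ 1).  A first white tile of
-- length n - i leaves a tiling counted by a(r, i).
total-suc : ∀ h h' → (∀ k t → h (white k ∷ t) ≡ h' t) → ∀ r n →
  total h (suc r) n ≡ total (h ∘ (red ∷_)) r n + sumBelow n (total h' (suc r))
total-suc h h' forget r n = begin
  lengthWeight (restrict (suc r) h) (n + suc r)
    ≡⟨ cong (lengthWeight (restrict (suc r) h)) (+-suc n r) ⟩
  lengthWeight (restrict (suc r) h) (suc (n + r))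
    ≡⟨ lengthWeight-suc (restrict (suc r) h) (restrict (suc r) h') (restrict-forget {h} {h'} forget (suc r)) (n + r) ⟩
  total (h ∘ (red ∷_)) r n + sumBelow (suc (n + r)) (lengthWeight (restrict (suc r) h'))
    ≡⟨ cong (λ L → total (h ∘ (red ∷_)) r n + sumBelow L (lengthWeight (restrict (suc r) h'))) (sym (+-suc n r)) ⟩
  total (h ∘ (red ∷_)) r n + sumBelow (n + suc r) (lengthWeight (restrict (suc r) h'))
    ≡⟨ cong (total (h ∘ (red ∷_)) r n +_) (whitesFirst h' (suc r) n) ⟩
  total (h ∘ (red ∷_)) r n + sumBelow n (total h' (suc r)) ∎

total-zero : ∀ h h' → (∀ k t → h (white k ∷ t) ≡ h' t) → ∀ m →
  total h 0 (suc m) ≡ sumBelow (suc m) (total h' 0)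
total-zero h h' forget m = begin
  lengthWeight (restrict 0 h) (suc (m + 0))
    ≡⟨ lengthWeight-suc (restrict 0 h) (restrict 0 h') (restrict-forget {h} {h'} forget 0) (m + 0) ⟩
  lengthWeight (restrict 0 h ∘ (red ∷_)) (m + 0) + sumBelow (suc m + 0) (lengthWeight (restrict 0 h'))
    ≡⟨ cong₂ _+_ (sum-map-zero (restrict 0 h ∘ (red ∷_)) (tilingsOfLength (m + 0)) (λ _ → refl))
                 (whitesFirst h' 0 (suc m)) ⟩
  sumBelow (suc m) (total h' 0) ∎

one : List Tile → ℕ
one _ = 1

whites : List Tile → ℕ
whites []            = 0
whites (red ∷ t)     = whites t
whites (white _ ∷ t) = suc (whites t)

whiteCount : ℕ → ℕ → ℕ
whiteCount = total whites

length-as-sum : ∀ (xs : List (List Tile)) → length xs ≡ sum (map one xs)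
length-as-sum []       = refl
length-as-sum (x ∷ xs) = cong suc (length-as-sum xs)

a-as-total : ∀ r n → a r n ≡ total one r n
a-as-total r n = trans (length-as-sum (tilingsA r n)) (filter-as-restrict r one (tilingsOfLength (n + r)))

length-split : ∀ t → length t ≡ reds t + whites t
length-split []            = refl
length-split (red ∷ t)     = cong suc (length-split t)
length-split (white _ ∷ t) = trans (cong suc (length-split t)) (sym (+-suc (reds t) (whites t)))

restrict-only : ∀ r h h' t → (reds t ≡ r → h t ≡ h' t) → restrict r h t ≡ restrict r h' t
restrict-only r h h' t same with reds t ≟ r
... | yes p = cong (λ x → if does (reds t ≟ r) then x else 0) (same p)
... | no ¬p rewrite dec-false (reds t ≟ r) ¬p = refl

Ca-split : ∀ r n → Ca r n ≡ r * a r n + whiteCount r n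
Ca-split r n = begin
  Ca r n
    ≡⟨ filter-as-restrict r length (tilingsOfLength (n + r)) ⟩
  total length r n
    ≡⟨ weigh-cong (λ t → restrict-only r length (λ t → r * one t + whites t) t (exactlyRRed t)) (tilingsOfLength (n + r)) ⟩
  total (λ t → r * one t + whites t) r n
    ≡⟨ total-+ (λ t → r * one t) whites r n ⟩
  total (λ t → r * one t) r n + whiteCount r n
    ≡⟨ cong (_+ whiteCount r n) (trans (total-* r one r n) (cong (r *_) (sym (a-as-total r n)))) ⟩
  r * a r n + whiteCount r n ∎
  where
  exactlyRRed : ∀ t → reds t ≡ r → length t ≡ r * one t + whites t
  exactlyRRed t refl = trans (length-split t) (cong (_+ whites t) (sym (*-identityʳ (reds t))))

-- After a leading white tile, a tiling contributes one more white tile.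
total-afterWhite : ∀ r i → total (λ t → one t + whites t) r i ≡ a r i + whiteCount r i
total-afterWhite r i = trans (total-+ one whites r i) (cong (_+ whiteCount r i) (sym (a-as-total r i)))

a-suc : ∀ r n → a (suc r) n ≡ a r n + sumBelow n (a (suc r))
a-suc r n = begin
  a (suc r) n                                      ≡⟨ a-as-total (suc r) n ⟩
  total one (suc r) n                              ≡⟨ total-suc one one (λ _ _ → refl) r n ⟩
  total one r n + sumBelow n (total one (suc r))   ≡⟨ cong₂ _+_ (sym (a-as-total r n))
                                                          (sumBelow-cong n (λ i _ → sym (a-as-total (suc r) i))) ⟩
  a r n + sumBelow n (a (suc r))                   ∎

whiteCount-suc : ∀ r n →
  whiteCount (suc r) n ≡ whiteCount r n + sumBelow n (λ i → a (suc r) i + whiteCount (suc r) i)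
whiteCount-suc r n =
  trans (total-suc whites (λ t → one t + whites t) (λ _ _ → refl) r n)
        (cong (whiteCount r n +_) (sumBelow-cong n (λ i _ → total-afterWhite (suc r) i)))

whiteCount-zero : ∀ n → whiteCount 0 n ≡ sumBelow n (λ i → a 0 i + whiteCount 0 i)
whiteCount-zero zero    = refl
whiteCount-zero (suc m) =
  trans (total-zero whites (λ t → one t + whites t) (λ _ _ → refl) m)
        (sumBelow-cong (suc m) (λ i _ → total-afterWhite 0 i))

closedForm : ∀ r (X : ℕ → ℕ) →
  (∀ n → X n ≡ r * sumBelow n (a r) + sumBelow n (λ i → a r i + X i)) →
  ∀ n → X n ≡ suc r * sumBelow n (a (suc r))
closedForm r X recurrence = <-rec (λ n → X n ≡ suc r * sumBelow n (a (suc r))) step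
  where
  S : ℕ → ℕ
  S i = sumBelow i (a (suc r))

  regroup : ∀ q A C → q * A + (A + suc q * C) ≡ suc q * (A + C)
  regroup = solve-∀

  step : ∀ n → (∀ {i} → i < n → X i ≡ suc r * S i) → X n ≡ suc r * S n
  step n ih = begin
    X n
      ≡⟨ recurrence n ⟩
    r * sumBelow n (a r) + sumBelow n (λ i → a r i + X i)
      ≡⟨ cong (r * sumBelow n (a r) +_) (sumBelow-cong n (λ i i<n → cong (a r i +_) (ih i<n))) ⟩
    r * sumBelow n (a r) + sumBelow n (λ i → a r i + suc r * S i)
      ≡⟨ cong (r * sumBelow n (a r) +_)
              (trans (sumBelow-+ (a r) (λ i → suc r * S i) n) (cong (sumBelow n (a r) +_) (sumBelow-* (suc r) S n))) ⟩
    r * sumBelow n (a r) + (sumBelow n (a r) + suc r * sumBelow n S)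
      ≡⟨ regroup r (sumBelow n (a r)) (sumBelow n S) ⟩
    suc r * (sumBelow n (a r) + sumBelow n S)
      ≡⟨ cong (suc r *_) (sym (trans (sumBelow-cong n (λ i _ → a-suc r i)) (sumBelow-+ (a r) S n))) ⟩
    suc r * S n ∎

whiteCount-closed : ∀ r n → whiteCount r n ≡ suc r * sumBelow n (a (suc r))
whiteCount-closed zero    = closedForm 0 (whiteCount 0) whiteCount-zero
whiteCount-closed (suc r) = closedForm (suc r) (whiteCount (suc r))
  (λ n → trans (whiteCount-suc r n) (cong (_+ sumBelow n (λ i → a (suc r) i + whiteCount (suc r) i)) (whiteCount-closed r n)))

mainTheorem15 : (r n : ℕ) → 1 ≤ r → 1 ≤ n →
    Ca r n ≡ (r + 1) * aS 1 (r + 1) (n ∸ 1) + r * aS 0 r n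
mainTheorem15 r (suc m) _ _ = begin
  Ca r n
    ≡⟨ Ca-split r n ⟩
  r * a r n + whiteCount r n
    ≡⟨ cong (r * a r n +_) (whiteCount-closed r n) ⟩
  r * a r n + suc r * sumBelow n (a (suc r))
    ≡⟨ +-comm (r * a r n) _ ⟩
  suc r * sumBelow n (a (suc r)) + r * a r n
    ≡⟨ cong (λ q → q * sumBelow n (a q) + r * a r n) (+-comm 1 r) ⟩
  (r + 1) * sumBelow n (a (r + 1)) + r * a r n
    ≡⟨ cong (λ s → (r + 1) * s + r * a r n) (sym (sum-upTo (a (r + 1)) n)) ⟩
  (r + 1) * aS 1 (r + 1) m + r * aS 0 r n ∎
  where
  n : ℕ
  n = suc m
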